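{- Let $f=(\alpha_1\cdots\alpha_n)$ be an $n$-player rule. Let $P\in\mathcal{L}$ and let $Q\in\mathrm{Sol}_fP$, i.e. $P\to Q$ is a solution move. Then $\mathrm{ord}_fQ\leqslant n-1$ and $\mathrm{ord}_fP=\mathrm{ord}_fQ+1$.
   Context: Positions are finite tuples $P=(a_1,\dots,a_k)$ of integers with $a_1\geqslant\dots\geqslant a_k\geqslant0$, where tuples differing only by trailing zeros are identified. $(0)$ is the empty position, $\mathcal{L}$ is the set of positions other than $(0)$, and $|P|=\sum a_i$ is the volume of $P$. A chomp move $P\to Q$ from $P=(a_1,\dots,a_k)$ chooses $1\leqslant x\leqslant k$ and an integer $a\geqslant0$, and sets $Q=(b_1,\dots,b_k)$ with $b_j=a_j$ for $j<x$ and $b_j=\min(a_j,a)$ for $j\geqslant x$, where $Q$ must be a different position from $P$. Write $\mathrm{Mov}P=\{Q: P\to Q\}$. Note that $(0)\in\mathrm{Mov}P$ for every $P\in\mathcal{L}$. An $n$-player rule is a tuple $f=(\alpha_1\cdots\alpha_n)$ of distinct reals. Ordinals $\mathrm{ord}_f$ are defined recursively on volume as follows. - $\mathrm{ord}_f(0)=0$. - For a position $Q$ whose ordinal is known, set $s_f(Q)=\alpha_{\mathrm{ord}_fQ+1}$ if $\mathrm{ord}_fQ<n$ and $s_f(Q)=\alpha_1$ if $\mathrm{ord}_fQ=n$. This is the score obtained by a player who moves to $Q$ when all players play optimally. - For $P\in\mathcal{L}$, $\mathrm{ord}_fP$ is the unique $i\in\{1,\dots,n\}$ with $\alpha_i=\max_{Q\in\mathrm{Mov}P}s_f(Q)$.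 Thus $\alpha_{\mathrm{ord}_fP}$ is player 1's score under optimal play from $P$. The solution set is defined as follows. If $s_f((0))$ equals this maximum, then $\mathrm{Sol}_fP=\{(0)\}$ (player's preference). Otherwise $\mathrm{Sol}_fP$ is the set of $Q\in\mathrm{Mov}P$ with $s_f(Q)=\max_{Q'\in\mathrm{Mov}P}s_f(Q')$. A move $P\to Q$ with $Q\in\mathrm{Sol}_fP$ is called a solution move. -}

module Defs where

open import Level using (Level)
open import Data.Nat using (ℕ; zero; suc; _<_; _⊓_; _≟_; _<?_)
open import Data.Nat.Properties using () renaming (_≟_ to _≟ℕ_)
open import Data.Fin using (Fin; toℕ; fromℕ<)
import Data.Fin as Fin
open import Data.List using (List; []; _∷_; length; take; drop; map; _++_; reverse; dropWhile; filter; concatMap; upTo; foldr)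
open import Data.Nat.ListAction using (sum)
open import Data.List.Properties using (≡-dec)
open import Data.List.Relation.Unary.All using (All)
open import Data.List.Relation.Unary.Linked using (Linked)
open import Data.Product using (Σ; ∃; _×_; _,_)
open import Data.Sum using (_⊎_)
open import Relation.Binary.Bundles using (StrictTotalOrder)
open import Relation.Binary.Definitions using (tri<; tri≈; tri>)
open import Relation.Binary.PropositionalEquality using (_≡_; _≢_)
open import Relation.Nullary using (¬_; yes; no; ¬?)
open import Data.Nat using (_≥_)

-- A position (a₁ ≥ … ≥ a_k ≥ 0), up to trailing zeros, is represented by
-- its canonical representative: a list with all trailing zeros removed,
-- i.e. a non-increasing list of positive naturals.  The empty position
-- (0) is the empty list [].

Pos : Set
Pos = List ℕ

Valid : Pos → Set
Valid P = Linked _≥_ P × All (λ a → 0 < a) P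

volume : Pos → ℕ
volume = sum

normalize : List ℕ → List ℕ
normalize l = reverse (dropWhile (λ a → a ≟ℕ 0) (reverse l))

-- the chomp move with parameters x (0-indexed: x here is the paper's x − 1,
-- so the first x entries are kept) and a: b_j = min(a_j, a) for later j.
moveTo : Pos → ℕ → ℕ → Pos
moveTo P x a = normalize (take x P ++ map (_⊓ a) (drop x P))

Move : Pos → Pos → Set
Move P Q = Σ ℕ λ x → Σ ℕ λ a → x < length P × Q ≡ moveTo P x a × Q ≢ P

-- explicit finite enumeration of Mov P (possibly with repetitions);
-- choices a > a₁ only reproduce P, so a ranges over 0 … a₁.
head0 : Pos → ℕ
head0 []      = 0
head0 (a ∷ _) = a

movesList : Pos → List Pos
movesList P =
  filter (λ Q → ¬? (≡-dec _≟ℕ_ Q P))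
    (concatMap (λ x → map (moveTo P x) (upTo (suc (head0 P)))) (upTo (length P)))

-- An n-player rule is a tuple of distinct reals; only their order
-- matters, so we allow values in an arbitrary strict total order S
-- (the reals being a special case).  The number of players is n = suc m,
-- and α : Fin (suc m) → Carrier, with α zero = α₁, …, α (fromℕ m) = α_n.

module Rule {c ℓ₁ ℓ₂ : Level} (S : StrictTotalOrder c ℓ₁ ℓ₂) (m : ℕ)
            (α : Fin (suc m) → StrictTotalOrder.Carrier S) where

  open StrictTotalOrder S using (Carrier; _≈_; compare)

  -- index (0-based) of the score s_f obtained by moving to a position of
  -- ordinal o:  α_{o+1} if o < n,  α₁ if o = n
  scoreIdx : ℕ → Fin (suc m)
  scoreIdx o with o <? suc m
  ... | yes p = fromℕ< p
  ... | no  _ = Fin.zero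

  best : Fin (suc m) → Fin (suc m) → Fin (suc m)
  best i j with compare (α i) (α j)
  ... | tri< _ _ _ = j
  ... | tri≈ _ _ _ = i
  ... | tri> _ _ _ = i

  maxA : Carrier → Carrier → Carrier
  maxA x y with compare x y
  ... | tri< _ _ _ = y
  ... | tri≈ _ _ _ = x
  ... | tri> _ _ _ = x

  -- ordinals, by recursion with fuel (fuel |P|+1 suffices since every
  -- move strictly decreases volume).  The fold is seeded with the score
  -- index of the empty position, which belongs to Mov P for P ≠ (0).
  ordF : ℕ → Pos → ℕ
  ordF zero    _       = 0
  ordF (suc k) []      = 0
  ordF (suc k) (a ∷ P) =
    suc (toℕ (foldr best (scoreIdx 0)
                (map (λ Q → scoreIdx (ordF k Q)) (movesList (a ∷ P)))))

  ord : Pos → ℕ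
  ord P = ordF (suc (volume P)) P

  s : Pos → Carrier
  s Q = α (scoreIdx (ord Q))

  maxScore : Pos → Carrier
  maxScore P = foldr maxA (s []) (map s (movesList P))

  Sol : Pos → Pos → Set ℓ₁
  Sol P Q = (s [] ≈ maxScore P × Q ≡ [])
          ⊎ (¬ (s [] ≈ maxScore P) × Move P Q × s Q ≈ maxScore P)

-- Every option of a position P ≠ (0) yields a score α_i, and ord P − 1 is the index of the largest
-- of them.  A solution move reaches a position Q whose score attains that maximum, and distinct
-- indices carry distinct values, so the index of s Q is ord P − 1.  When Q ≠ (0), the index of
-- s Q is ord Q itself: otherwise ord Q = n and s Q = α₁ = s (0), which would make (0) a solution.
module Submission where

open import Defs
open import Data.Nat using (ℕ; zero; suc; _+_; _≤_; _<_; _⊓_; _<?_; z≤n; s≤s; s≤s⁻¹)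
open import Data.Nat.Properties
  using (≤-refl; ≤-antisym; ≤∧≢⇒<; <-≤-trans; +-mono-≤; +-cancelʳ-≤; +-cancelˡ-≡; m⊓n≤m; n>0⇒n≢0)
  renaming (_≟_ to _≟ℕ_)
open import Data.Nat.ListAction using (sum)
open import Data.Nat.ListAction.Properties using (sum-↭)
open import Data.Fin using (Fin; toℕ)
import Data.Fin as Fin
open import Data.Fin.Properties using (toℕ-fromℕ<)
open import Data.List using (List; []; _∷_; _++_; take; drop; map; reverse; dropWhile; foldr; upTo; length)
open import Data.List.Properties using (reverse-involutive; map-∘; map-cong-local; foldr-fusion; foldr-map; ≡-dec)
open import Data.List.Relation.Unary.All using (All; []; _∷_; tabulate)
import Data.List.Relation.Unary.All as All
open import Data.List.Relation.Unary.Any using (satisfied)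
open import Data.List.Relation.Binary.Pointwise using (Pointwise; []; _∷_)
open import Data.List.Relation.Binary.Permutation.Propositional using (↭-sym)
open import Data.List.Relation.Binary.Permutation.Propositional.Properties using (↭-reverse; All-resp-↭)
open import Data.List.Membership.Propositional using (_∈_)
open import Data.List.Membership.Propositional.Properties using (∈-filter⁻; ∈-concatMap⁻; ∈-map⁻)
open import Data.Product using (_×_; _,_)
open import Data.Sum using (inj₁; inj₂)
open import Function using (_∘_)
open import Relation.Nullary using (¬_; ¬?; yes; no; contradiction)
open import Relation.Nullary.Decidable using (decidable-stable)
open import Relation.Unary using (Pred; Decidable)
open import Relation.Binary.Bundles using (StrictTotalOrder)
open import Relation.Binary.Definitions using (tri<; tri≈; tri>)
open import Relation.Binary.PropositionalEquality using (_≡_; _≢_; refl; sym; trans; cong; subst; module ≡-Reasoning)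

dropWhile-idem : ∀ {a p} {A : Set a} {P : Pred A p} (P? : Decidable P) xs →
  dropWhile P? (dropWhile P? xs) ≡ dropWhile P? xs
dropWhile-idem P? [] = refl
dropWhile-idem P? (x ∷ xs) with P? x
... | yes _ = dropWhile-idem P? xs
... | no ¬px with P? x
...   | yes px = contradiction px ¬px
...   | no _   = refl

dropWhile-all-fail : ∀ {a p} {A : Set a} {P : Pred A p} (P? : Decidable P) {xs} →
  All (¬_ ∘ P) xs → dropWhile P? xs ≡ xs
dropWhile-all-fail P? [] = refl
dropWhile-all-fail P? {x ∷ _} (¬px ∷ _) with P? x
... | yes px = contradiction px ¬px
... | no _   = refl

sum-dropWhile-zero : ∀ xs → sum (dropWhile (_≟ℕ 0) xs) ≡ sum xs
sum-dropWhile-zero []           = refl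
sum-dropWhile-zero (zero  ∷ xs) = sum-dropWhile-zero xs
sum-dropWhile-zero (suc _ ∷ _)  = refl

sum-reverse : ∀ xs → sum (reverse xs) ≡ sum xs
sum-reverse xs = sum-↭ (↭-reverse xs)

sum-mono-≤ : ∀ {xs ys} → Pointwise _≤_ xs ys → sum xs ≤ sum ys
sum-mono-≤ []           = z≤n
sum-mono-≤ (x≤y ∷ rest) = +-mono-≤ x≤y (sum-mono-≤ rest)

Pointwise-≤∧sum-≡⇒≡ : ∀ {xs ys} → Pointwise _≤_ xs ys → sum xs ≡ sum ys → xs ≡ ys
Pointwise-≤∧sum-≡⇒≡ [] _ = refl
Pointwise-≤∧sum-≡⇒≡ {x ∷ xs} {y ∷ ys} (x≤y ∷ rest) eq
  with refl ← ≤-antisym x≤y (+-cancelʳ-≤ (sum xs) y x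
                (subst (y + sum xs ≤_) (sym eq) (+-mono-≤ (≤-refl {y}) (sum-mono-≤ rest))))
  = cong (x ∷_) (Pointwise-≤∧sum-≡⇒≡ rest (+-cancelˡ-≡ x _ _ eq))

Normalized : Pos → Set
Normalized P = normalize P ≡ P

volume-normalize : ∀ xs → volume (normalize xs) ≡ volume xs
volume-normalize xs = trans (sum-reverse (dropWhile (_≟ℕ 0) (reverse xs)))
                     (trans (sum-dropWhile-zero (reverse xs)) (sum-reverse xs))

normalize-normalized : ∀ xs → Normalized (normalize xs)
normalize-normalized xs
  rewrite reverse-involutive (dropWhile (_≟ℕ 0) (reverse xs))
        | dropWhile-idem (_≟ℕ 0) (reverse xs) = refl

valid⇒normalized : ∀ {P} → Valid P → Normalized P
valid⇒normalized {P} (_ , positive)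
  rewrite dropWhile-all-fail (_≟ℕ 0) (All-resp-↭ (↭-sym (↭-reverse P)) (All.map n>0⇒n≢0 positive))
  = reverse-involutive P

chomp-≤ : ∀ x a P → Pointwise _≤_ (take x P ++ map (_⊓ a) (drop x P)) P
chomp-≤ zero    a []      = []
chomp-≤ zero    a (p ∷ P) = m⊓n≤m p a ∷ chomp-≤ zero a P
chomp-≤ (suc x) a []      = []
chomp-≤ (suc x) a (p ∷ P) = ≤-refl ∷ chomp-≤ x a P

moveTo-volume-< : ∀ {P} x a → Normalized P → moveTo P x a ≢ P → volume (moveTo P x a) < volume P
moveTo-volume-< {P} x a normal moved =
  subst (_< sum P) (sym (volume-normalize raw)) (≤∧≢⇒< (sum-mono-≤ (chomp-≤ x a P)) unchanged)
  where
  raw = take x P ++ map (_⊓ a) (drop x P)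
  unchanged : sum raw ≢ sum P
  unchanged eq = moved (trans (cong normalize (Pointwise-≤∧sum-≡⇒≡ (chomp-≤ x a P) eq)) normal)

movesList-decreasing : ∀ {P Q} → Normalized P → Q ∈ movesList P → Normalized Q × volume Q < volume P
movesList-decreasing {P} normal Q∈ with ∈-filter⁻ (λ Q → ¬? (≡-dec _≟ℕ_ Q P)) Q∈
... | Q∈moves , Q≢P with satisfied (∈-concatMap⁻ _ {xs = upTo (length P)} Q∈moves)
... | x , Q∈row with ∈-map⁻ (moveTo P x) Q∈row
... | a , _ , refl =
  normalize-normalized (take x P ++ map (_⊓ a) (drop x P)) , moveTo-volume-< x a normal Q≢P

module RuleProperties {c ℓ₁ ℓ₂} (S : StrictTotalOrder c ℓ₁ ℓ₂) (m : ℕ)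
                      (α : Fin (suc m) → StrictTotalOrder.Carrier S) where
  open Rule S m α
  open StrictTotalOrder S using (_≈_; compare)

  α-best : ∀ i j → α (best i j) ≡ maxA (α i) (α j)
  α-best i j with compare (α i) (α j)
  ... | tri< _ _ _ = refl
  ... | tri≈ _ _ _ = refl
  ... | tri> _ _ _ = refl

  α-foldr-best : ∀ i is → α (foldr best i is) ≡ foldr maxA (α i) (map α is)
  α-foldr-best i is = trans (foldr-fusion α i α-best is) (sym (foldr-map maxA α (α i) is))

  scoreIdx-< : ∀ {o} → o < suc m → toℕ (scoreIdx o) ≡ o
  scoreIdx-< {o} o<n with o <? suc m
  ... | yes p = toℕ-fromℕ< p
  ... | no ¬p = contradiction o<n ¬p

  scoreIdx-≮ : ∀ {o} → ¬ o < suc m → scoreIdx o ≡ Fin.zero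
  scoreIdx-≮ {o} o≮n with o <? suc m
  ... | yes p = contradiction p o≮n
  ... | no _  = refl

  ordF-fuel-irrelevant : ∀ k k' Q → Normalized Q → volume Q < k → volume Q < k' → ordF k Q ≡ ordF k' Q
  ordF-fuel-irrelevant (suc j) (suc j') []      _      _       _        = refl
  ordF-fuel-irrelevant (suc j) (suc j') (a ∷ R) normal (s≤s q<) (s≤s q<') =
    cong (λ is → suc (toℕ (foldr best (scoreIdx 0) is))) (map-cong-local (tabulate λ Q'∈ →
      let normal' , smaller = movesList-decreasing normal Q'∈ in
      cong scoreIdx (ordF-fuel-irrelevant j j' _ normal' (<-≤-trans smaller q<) (<-≤-trans smaller q<'))))

  bestIdx : Pos → Fin (suc m)
  bestIdx P = foldr best (scoreIdx 0) (map (scoreIdx ∘ ord) (movesList P))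

  α-bestIdx : ∀ P → α (bestIdx P) ≡ maxScore P
  α-bestIdx P = trans (α-foldr-best (scoreIdx 0) (map (scoreIdx ∘ ord) (movesList P)))
                      (cong (foldr maxA (s [])) (sym (map-∘ (movesList P))))

  ord-bestIdx : ∀ {P} → Valid P → P ≢ [] → ord P ≡ suc (toℕ (bestIdx P))
  ord-bestIdx {[]}    _     P≢[] = contradiction refl P≢[]
  ord-bestIdx {a ∷ R} valid _    =
    cong (λ is → suc (toℕ (foldr best (scoreIdx 0) is))) (map-cong-local (tabulate λ Q∈ →
      let normal , smaller = movesList-decreasing (valid⇒normalized valid) Q∈ in
      cong scoreIdx (ordF-fuel-irrelevant _ _ _ normal smaller ≤-refl)))

  module _ (α-injective : ∀ i j → α i ≈ α j → i ≡ j) where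

    ord-maximizer : ∀ {P o} → Valid P → P ≢ [] → o < suc m → α (scoreIdx o) ≈ maxScore P →
      ord P ≡ suc o
    ord-maximizer {P} {o} valid P≢[] o<n attains = begin
      ord P                      ≡⟨ ord-bestIdx valid P≢[] ⟩
      suc (toℕ (bestIdx P))      ≡⟨ cong (suc ∘ toℕ) (sym maximizer) ⟩
      suc (toℕ (scoreIdx o))     ≡⟨ cong suc (scoreIdx-< o<n) ⟩
      suc o                      ∎
      where
      open ≡-Reasoning
      maximizer : scoreIdx o ≡ bestIdx P
      maximizer = α-injective _ _ (subst (α (scoreIdx o) ≈_) (sym (α-bestIdx P)) attains)

  optimal⇒ord< : ∀ P {Q} → ¬ s [] ≈ maxScore P → s Q ≈ maxScore P → ord Q < suc m
  optimal⇒ord< P empty-not-optimal Q-optimal = decidable-stable (ord _ <? suc m) λ ordQ≮n →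
    empty-not-optimal (subst (λ i → α i ≈ maxScore P) (scoreIdx-≮ ordQ≮n) Q-optimal)

theorem2p7 : ∀ {c ℓ₁ ℓ₂} (S : StrictTotalOrder c ℓ₁ ℓ₂) (m : ℕ)
    (α : Fin (suc m) → StrictTotalOrder.Carrier S) →
    (∀ i j → StrictTotalOrder._≈_ S (α i) (α j) → i ≡ j) →
    (P Q : Pos) → Valid P → P ≢ [] → Rule.Sol S m α P Q →
    (Rule.ord S m α Q ≤ m) × (Rule.ord S m α P ≡ suc (Rule.ord S m α Q))
theorem2p7 S m α α-injective P Q valid P≢[] (inj₁ (empty-optimal , refl)) =
  z≤n , RuleProperties.ord-maximizer S m α α-injective valid P≢[] (s≤s z≤n) empty-optimal
theorem2p7 S m α α-injective P Q valid P≢[] (inj₂ (empty-not-optimal , _ , Q-optimal)) =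
  s≤s⁻¹ ordQ<n , ord-maximizer α-injective valid P≢[] ordQ<n Q-optimal
  where
  open RuleProperties S m α
  ordQ<n : Rule.ord S m α Q < suc m
  ordQ<n = optimal⇒ord< P empty-not-optimal Q-optimal
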